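{- Let $J$ be a process of the core join-calculus and let $N(J) = (P, T, m_0)$ be its Petri net semantics. If $N(J)$ contains a fully reachable M-structure, then this M-structure is local, i.e. all three of its transitions carry the same label (the same join definition).
   Context: Core join-calculus processes are generated by $P ::= 0 \mid x\langle v\rangle \mid P \mid P \mid \mathsf{def}\ x\langle u\rangle \mid y\langle v\rangle \triangleright P\ \mathsf{in}\ P$. $N(J)$ is a labeled Petri net whose transitions are labeled by join definitions. Its places are triples $(x\langle a\rangle, s, s_a)$: a message, the stack of join definitions scoping the sender name $x$, and the stack scoping the sent name $a$. The initial marking is the decomposition of $J$; the decomposition pushes each enclosing definition onto the scope stacks and then pops each stack until the top definition defines the name, or the stack is empty. $N(J)$ is the smallest net containing this initial marking and satisfying the following transition rule. For every two places $p=(x\langle a\rangle, s, s_a)$ and $q=(y\langle b\rangle, s, s_b)$ with the same sender stack $s$ whose top element is $D = x\langle u\rangle \mid y\langle v\rangle \triangleright R$, there is a transition with preset $\{p,q\}$ and label $D$. Its postset consists of fresh places obtained by decomposing $R$ with $u \mapsto (a,s_a)$, $v \mapsto (b,s_b)$, and every other name $n \mapsto (n,s)$. In particular, every place in the preset of a transition has as the top of its sender stack exactly the label of that transition. An M-structure is a net fragment with two places $p,q$ and three transitions $t_1,t_2,t_3$, where $p$ is in the preset of $t_1$ and $t_2$, and $q$ is in the preset of $t_2$ and $t_3$. It is fully reachable if some reachable marking contains both $p$ and $q$. It is called local if $l(t_1)=l(t_2)=l(t_3)$. -}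

module Defs where

open import Data.Nat using (ℕ; zero; suc; _≤_; _<?_; _∸_; _+_; _≡ᵇ_)
open import Data.Nat.Properties using () renaming (_≟_ to _≟ℕ_)
open import Data.Bool using (Bool; true; false; if_then_else_; _∨_)
open import Data.List using (List; []; _∷_; _++_; length)
open import Data.Maybe using (Maybe; just; nothing)
open import Data.Product using (_×_; _,_; proj₁; proj₂; ∃)
open import Data.Sum using (_⊎_)
open import Relation.Nullary using (¬_; Dec; yes; no; does)
open import Relation.Binary.PropositionalEquality using (_≡_; _≢_; refl; cong)

Name : Set
Name = ℕ

data Proc : Set
record JDef : Set

-- a join definition  x⟨u⟩ | y⟨v⟩ ▷ body
record JDef where
  inductive
  constructor jdef
  field
    x u y v : Name
    body    : Proc

data Proc where
  𝟘      : Proc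
  msg    : Name → Name → Proc
  _∥_    : Proc → Proc → Proc
  def_within_ : JDef → Proc → Proc

-- stacks of join definitions (head = top)
Stack : Set
Stack = List JDef

defines : JDef → Name → Bool
defines D n = (JDef.x D ≡ᵇ n) ∨ (JDef.y D ≡ᵇ n)

pop : Name → Stack → Stack
pop n [] = []
pop n (D ∷ s) = if defines D n then D ∷ s else pop n s

record Triple : Set where
  constructor mk
  field
    sender  : Name
    arg     : Name
    sstack  : Stack
    astack  : Stack

-- environment: each name is mapped to an (actual name, scope stack)
Env : Set
Env = Name → Name × Stack

push : JDef → Env → Env
push D σ n = proj₁ (σ n) , D ∷ proj₂ (σ n)

decomp : Env → Proc → List Triple
decomp σ 𝟘 = []
decomp σ (msg x v) =
  mk (proj₁ (σ x)) (proj₁ (σ v))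
     (pop (proj₁ (σ x)) (proj₂ (σ x)))
     (pop (proj₁ (σ v)) (proj₂ (σ v))) ∷ []
decomp σ (P ∥ Q) = decomp σ P ++ decomp σ Q
decomp σ (def D within Q) = decomp (push D σ) Q

initEnv : Env
initEnv n = n , []

-- environment for decomposing the body R of D = x⟨u⟩|y⟨v⟩ ▷ R when firing
-- on x⟨a⟩ (stack s_a for a) and y⟨b⟩ (stack s_b for b), sender stack s:
-- u ↦ (a,s_a), v ↦ (b,s_b), every other name n ↦ (n,s)
fireEnv : JDef → Name → Stack → Name → Stack → Stack → Env
fireEnv D a sa b sb s n =
  if JDef.u D ≡ᵇ n then (a , sa)
  else if JDef.v D ≡ᵇ n then (b , sb)
  else (n , s)

postDecomp : JDef → Name → Stack → Name → Stack → Stack → List Triple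
postDecomp D a sa b sb s = decomp (fireEnv D a sa b sb s) (JDef.body D)

lookupL : {A : Set} → List A → ℕ → Maybe A
lookupL [] k = nothing
lookupL (a ∷ as) zero = just a
lookupL (a ∷ as) (suc k) = lookupL as k

-- Place identities: places are fresh, so they are identified by their
-- origin: the k-th place of the initial marking, or the k-th place of
-- the postset of the transition with ordered preset (p , q).

data PlaceId : Set where
  initP : ℕ → PlaceId
  postP : PlaceId → PlaceId → ℕ → PlaceId

postP-inj : ∀ {p q k p' q' k'} → postP p q k ≡ postP p' q' k' →
            (p ≡ p') × (q ≡ q') × (k ≡ k')
postP-inj refl = refl , refl , refl

_≟P_ : (p q : PlaceId) → Dec (p ≡ q)
initP m ≟P initP n with m ≟ℕ n
... | yes refl = yes refl
... | no ne = no λ { refl → ne refl }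
initP _ ≟P postP _ _ _ = no λ ()
postP _ _ _ ≟P initP _ = no λ ()
postP p q k ≟P postP p' q' k' with p ≟P p' | q ≟P q' | k ≟ℕ k'
... | yes refl | yes refl | yes refl = yes refl
... | no ne | _ | _ = no λ e → ne (proj₁ (postP-inj e))
... | yes _ | no ne | _ = no λ e → ne (proj₁ (proj₂ (postP-inj e)))
... | yes _ | yes _ | no ne = no λ e → ne (proj₂ (proj₂ (postP-inj e)))

data IsPlace (J : Proc) : PlaceId → Triple → Set where
  initial : ∀ {k c} → lookupL (decomp initEnv J) k ≡ just c →
            IsPlace J (initP k) c
  fresh   : ∀ {p q x u y v R s a sa b sb k c} →
            IsPlace J p (mk x a (jdef x u y v R ∷ s) sa) →
            IsPlace J q (mk y b (jdef x u y v R ∷ s) sb) →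
            p ≢ q →
            lookupL (postDecomp (jdef x u y v R) a sa b sb (jdef x u y v R ∷ s)) k
              ≡ just c →
            IsPlace J (postP p q k) c

-- Trans J p q D : there is a transition with preset {p , q}
-- (p the x-message, q the y-message) and label D
data Trans (J : Proc) : PlaceId → PlaceId → JDef → Set where
  fire : ∀ {p q x u y v R s a sa b sb} →
         IsPlace J p (mk x a (jdef x u y v R ∷ s) sa) →
         IsPlace J q (mk y b (jdef x u y v R ∷ s) sb) →
         p ≢ q →
         Trans J p q (jdef x u y v R)

postsetT : ∀ {J p q D} → Trans J p q D → List Triple
postsetT (fire {x = x} {u} {y} {v} {R} {s} {a} {sa} {b} {sb} _ _ _) =
  postDecomp (jdef x u y v R) a sa b sb (jdef x u y v R ∷ s)

Marking : Set
Marking = PlaceId → ℕ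

δ : PlaceId → PlaceId → ℕ
δ p r = if does (p ≟P r) then 1 else 0

m₀ : Proc → Marking
m₀ J (initP k) = if does (k <? length (decomp initEnv J)) then 1 else 0
m₀ J (postP _ _ _) = 0

-- tokens produced in r by firing the transition with preset (p , q)
-- whose postset has n places  postP p q 0 , … , postP p q (n-1)
postCount : PlaceId → PlaceId → ℕ → PlaceId → ℕ
postCount p q n (initP _) = 0
postCount p q n (postP p' q' k) =
  if does (p ≟P p') then (if does (q ≟P q') then (if does (k <? n) then 1 else 0) else 0) else 0

fireM : ∀ {J p q D} → Marking → Trans J p q D → Marking
fireM {p = p} {q} M t r =
  ((M r ∸ δ p r) ∸ δ q r) + postCount p q (length (postsetT t)) r

data Reachable (J : Proc) : Marking → Set where
  start : Reachable J (m₀ J)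
  step  : ∀ {M p q D} → Reachable J M → (t : Trans J p q D) →
          1 ≤ M p → 1 ≤ M q → Reachable J (fireM M t)

record Transition (J : Proc) : Set where
  constructor transition
  field
    pre₁ pre₂ : PlaceId
    label     : JDef
    isTrans   : Trans J pre₁ pre₂ label

open Transition public

_∈pre_ : ∀ {J} → PlaceId → Transition J → Set
r ∈pre t = (r ≡ pre₁ t) ⊎ (r ≡ pre₂ t)

_≢T_ : ∀ {J} → Transition J → Transition J → Set
t ≢T t' = ¬ ((pre₁ t ≡ pre₁ t') × (pre₂ t ≡ pre₂ t'))

record MStructure (J : Proc) : Set where
  field
    p q        : PlaceId
    t₁ t₂ t₃   : Transition J
    p≢q        : p ≢ q
    t₁≢t₂      : t₁ ≢T t₂
    t₂≢t₃      : t₂ ≢T t₃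
    t₁≢t₃      : t₁ ≢T t₃
    p∈t₁       : p ∈pre t₁
    p∈t₂       : p ∈pre t₂
    q∈t₂       : q ∈pre t₂
    q∈t₃       : q ∈pre t₃

FullyReachable : ∀ {J} → MStructure J → Set
FullyReachable {J} m =
  ∃ λ M → Reachable J M × (1 ≤ M (MStructure.p m)) × (1 ≤ M (MStructure.q m))

Local : ∀ {J} → MStructure J → Set
Local m = (label (MStructure.t₁ m) ≡ label (MStructure.t₂ m))
        × (label (MStructure.t₂ m) ≡ label (MStructure.t₃ m))

module Submission where

-- The transition rule of N(J) only lets a transition with label D consume
-- places whose sender stack has D on top.  Hence the label of a transition
-- is read off from the content of any place in its preset, and two
-- transitions sharing a preset place carry the same label.  Since a place
-- identity determines its content (places are fresh: the initial places are
-- positions in the decomposition of J, the others positions in the postset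
-- of a unique firing), this needs no reachability information at all.
--
-- The theorem applies the last fact to p (shared by t₁, t₂) and to q
-- (shared by t₂, t₃); full reachability is a hypothesis it does not need.

open import Defs
open import Data.List using (head)
open import Data.Maybe using (just)
open import Data.Maybe.Properties using (just-injective)
open import Data.Product using (_,_; ∃; _×_)
open import Data.Sum using (inj₁; inj₂)
open import Relation.Binary.PropositionalEquality using (_≡_; refl; sym; trans)

-- The content of a place is a function of its identity: an initial place is
-- a fixed position of the initial decomposition, and a fresh place is a fixed
-- position in the postset computed from the (inductively unique) contents of
-- its two parents.
place-content-unique : ∀ {J r c c'} → IsPlace J r c → IsPlace J r c' → c ≡ c'
place-content-unique (initial at) (initial at') = just-injective (trans (sym at) at')
place-content-unique (fresh isP isQ _ at) (fresh isP' isQ' _ at')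
  with place-content-unique isP isP' | place-content-unique isQ isQ'
... | refl | refl = just-injective (trans (sym at) at')

preset-sender-top : ∀ {J} (t : Transition J) r → r ∈pre t →
                    ∃ λ c → IsPlace J r c × (head (Triple.sstack c) ≡ just (label t))
preset-sender-top (transition _ _ _ (fire isP _ _)) _ (inj₁ refl) = _ , isP , refl
preset-sender-top (transition _ _ _ (fire _ isQ _)) _ (inj₂ refl) = _ , isQ , refl

-- Two transitions that can both consume the same place have the same label:
-- both labels equal the top of that place's (unique) sender stack.
shared-preset-label : ∀ {J} (t t' : Transition J) r →
                      r ∈pre t → r ∈pre t' → label t ≡ label t'
shared-preset-label t t' r r∈t r∈t'
  with preset-sender-top t r r∈t | preset-sender-top t' r r∈t'
... | c , isR , top≡t | c' , isR' , top≡t'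
  with place-content-unique isR isR'
... | refl = just-injective (trans (sym top≡t) top≡t')

mainTheorem3 : (J : Proc) (m : MStructure J) → FullyReachable m → Local m
mainTheorem3 J m _ =
  shared-preset-label t₁ t₂ p p∈t₁ p∈t₂ , shared-preset-label t₂ t₃ q q∈t₂ q∈t₃
  where open MStructure m
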